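{- Let $q \geq 1$ and $s > a \geq 1$ be integers. Let $Q = v_1, e_1, \ldots, e_{s-1}, v_s$ be a path in a graph, and let $I$ be a nonempty independent subset of $\{v_1, \ldots, v_s\}$. Suppose $A'$ is a set of $a$ edges of $Q$ such that the distance in $Q$ from any edge in $A'$ to any vertex in $I$ is at least $q$. Then $|I| \leq \lfloor (s - a - q + 1)/2 \rfloor$ if $q \geq 2$, and $|I| \leq \lfloor (s - a + 1)/2 \rfloor = \lceil (s-a)/2 \rceil$ if $q = 1$.
   Context: A set of vertices of the path $Q$ is independent if it contains no two consecutive vertices $v_i, v_{i+1}$ of $Q$. The distance in $Q$ from the edge $e_i$ (with ends $v_i, v_{i+1}$) to the vertex $v_j$ is $\min\{|i-j|, |i+1-j|\}$. -}

module Defs where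

open import Data.Nat using (ℕ; suc; _+_; _⊓_; ∣_-_∣)
open import Data.Fin using (Fin; toℕ)
open import Data.Fin.Subset using (Subset; _∈_)
open import Relation.Binary.PropositionalEquality using (_≢_)

-- Path Q = v_1, e_1, ..., e_{s-1}, v_s.  We index 0-based:
-- vertex v_{i+1} is  i : Fin s ; edge e_{j+1} (ends v_{j+1}, v_{j+2}) is  j : Fin (s ∸ 1).

edgeVertexDist : ℕ → ℕ → ℕ
edgeVertexDist j i = ∣ j - i ∣ ⊓ ∣ suc j - i ∣

Independent : ∀ {s} → Subset s → Set
Independent {s} I = (i j : Fin s) → i ∈ I → j ∈ I → toℕ j ≢ suc (toℕ i)

NonemptySet : ∀ {s} → Subset s → Set
NonemptySet = Data.Fin.Subset.Nonempty

-- Number the vertices 0, …, s − 1 and put edge j between vertices j and j + 1.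
-- Since I is independent, I and its translate I + 1 are disjoint sets of
-- positions in [0, s], so 2|I| plus the size of any further set of positions
-- avoiding both is at most s + 1. It remains to find such a set of size a or
-- a + q. For q ≥ 1 the right endpoints of the edges of A' will do. For q ≥ 2,
-- either some edge of A' lies before the last vertex of I, and then an edge j
-- of A' followed by a vertex i of I with nothing of I ∪ A' in between yields
-- A' together with the q positions j + 1, …, j + q < i; or all of A' lies at
-- least q beyond the last vertex m of I, and then A' + 2 together with the
-- q positions m + 2, …, m + q + 1 will do.
module Submission where

open import Defs
open import Data.Nat using (ℕ; suc; _+_; _∸_; _/_; _≤_; _≥_)
open import Data.Fin using (Fin; toℕ)
open import Data.Fin.Subset using (Subset; _∈_; ∣_∣)
open import Data.Product using (_×_)
open import Relation.Binary.PropositionalEquality using (_≡_)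

open import Data.Bool using (Bool; true; false; T; _∨_; if_then_else_)
open import Data.Bool.Properties using (T-∨)
open import Data.Empty using (⊥; ⊥-elim)
open import Data.Fin using (zero; suc)
open import Data.Fin.Properties using (toℕ<n)
open import Data.Fin.Subset using (Nonempty; inside; outside)
open import Data.Fin.Subset.Properties using (nonempty?; Empty-unique; ∣⊥∣≡0)
open import Data.Nat using (zero; _<_; _*_; _<ᵇ_; z≤n; s≤s; ∣_-_∣; _⊓_)
open import Data.Nat.DivMod using (m*n/n≡m; /-monoˡ-≤)
open import Data.Nat.Properties
open import Data.Product using (∃; ∃₂; _,_; proj₁; proj₂; map)
open import Data.Sum using (inj₁; inj₂; [_,_])
open import Data.Vec using (_∷_; []; here; there)
open import Function using (_∘_; Equivalence)
open import Relation.Nullary using (¬_; yes; no; contradiction)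
open import Relation.Nullary.Decidable using (T?)
open import Relation.Binary.PropositionalEquality using (refl; sym; trans; cong; cong₂; subst; subst₂; module ≡-Reasoning)


private
  variable
    n q x i j : ℕ
    f g h : ℕ → Bool

count : (ℕ → Bool) → ℕ → ℕ
count f zero    = 0
count f (suc n) = if f 0 then suc (count (f ∘ suc) n) else count (f ∘ suc) n

_∪_ : (ℕ → Bool) → (ℕ → Bool) → ℕ → Bool
(f ∪ g) x = f x ∨ g x

shift : (ℕ → Bool) → ℕ → Bool
shift f zero    = false
shift f (suc x) = f x

interval : (lo len : ℕ) → ℕ → Bool
interval zero     len x = x <ᵇ len
interval (suc lo) len   = shift (interval lo len)

Disjoint : (ℕ → Bool) → (ℕ → Bool) → Set
Disjoint f g = ∀ x → T (f x) → T (g x) → ⊥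

count≤n : ∀ f n → count f n ≤ n
count≤n f zero = z≤n
count≤n f (suc n) with f 0
... | true  = s≤s (count≤n (f ∘ suc) n)
... | false = m≤n⇒m≤1+n (count≤n (f ∘ suc) n)

count-mono : ∀ f {m n} → m ≤ n → count f m ≤ count f n
count-mono f z≤n = z≤n
count-mono f (s≤s m≤n) with f 0
... | true  = s≤s (count-mono (f ∘ suc) m≤n)
... | false = count-mono (f ∘ suc) m≤n

count-∪ : ∀ f g n → Disjoint f g → count (f ∪ g) n ≡ count f n + count g n
count-∪ f g zero _ = refl
count-∪ f g (suc n) f∩g with f 0 | g 0 | f∩g 0 | count-∪ (f ∘ suc) (g ∘ suc) n (f∩g ∘ suc)
... | true  | true  | f₀∩g₀ | _  = ⊥-elim (f₀∩g₀ _ _)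
... | true  | false | _     | ih = cong suc ih
... | false | true  | _     | ih = trans (cong suc ih) (sym (+-suc _ _))
... | false | false | _     | ih = ih

count-interval : ∀ lo len → count (interval lo len) (lo + len) ≡ len
count-interval zero     zero      = refl
count-interval zero     (suc len) = cong suc (count-interval zero len)
count-interval (suc lo) len       = count-interval lo len

len≤count-interval : ∀ lo len → lo + len ≤ n → len ≤ count (interval lo len) n
len≤count-interval {n} lo len le =
  subst (_≤ count (interval lo len) n) (count-interval lo len) (count-mono (interval lo len) le)

interval-bounds : ∀ lo {len x} → T (interval lo len x) → lo ≤ x × x < lo + len
interval-bounds zero     {len} {x}     x<len = z≤n , <ᵇ⇒< x len x<len
interval-bounds (suc lo) {x = suc x} x∈    = map s≤s s≤s (interval-bounds lo x∈)

disjoint-∪ʳ : Disjoint f g → Disjoint f h → Disjoint f (g ∪ h)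
disjoint-∪ʳ f∩g f∩h x fx = [ f∩g x fx , f∩h x fx ] ∘ Equivalence.to T-∨

disjoint-separated : ∀ m → (∀ {x} → T (f x) → x < m) → (∀ {x} → T (g x) → m ≤ x) →
  Disjoint f g
disjoint-separated m below above x fx gx = <⇒≱ (below fx) (above gx)

disjoint-shift : Disjoint f g → Disjoint (shift f) (shift g)
disjoint-shift f∩g (suc x) = f∩g x

packing : Disjoint f (shift f) → Disjoint f g → Disjoint (shift f) g →
  count f n + count f n + count g (suc n) ≤ suc n
packing {f} {g} {n} f∩sf f∩g sf∩g = begin
  count f n + count f n + count g (suc n)
    ≤⟨ +-monoˡ-≤ _ (+-monoˡ-≤ _ (count-mono f (n≤1+n n))) ⟩
  count f (suc n) + count (shift f) (suc n) + count g (suc n)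
    ≡⟨ +-assoc (count f (suc n)) _ _ ⟩
  count f (suc n) + (count (shift f) (suc n) + count g (suc n))
    ≡⟨ cong (count f (suc n) +_) (count-∪ (shift f) g (suc n) sf∩g) ⟨
  count f (suc n) + count (shift f ∪ g) (suc n)
    ≡⟨ count-∪ f (shift f ∪ g) (suc n) (disjoint-∪ʳ f∩sf f∩g) ⟨
  count (f ∪ (shift f ∪ g)) (suc n)
    ≤⟨ count≤n (f ∪ (shift f ∪ g)) (suc n) ⟩
  suc n ∎
  where open ≤-Reasoning

greatest : (f : ℕ → Bool) (n : ℕ) → x < n → T (f x) →
  ∃ λ m → T (f m) × (∀ {y} → m < y → y < n → ¬ T (f y))
greatest f (suc n) x<1+n fx with T? (f n)
... | yes fn = n , fn , λ n<y y<1+n → contradiction (≤-pred y<1+n) (<⇒≱ n<y)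
... | no ¬fn with m≤n⇒m<n∨m≡n (≤-pred x<1+n)
...   | inj₂ refl = contradiction fx ¬fn
...   | inj₁ x<n with greatest f n x<n fx
...     | m , fm , above = m , fm , λ m<y y<1+n →
          [ above m<y , (λ { refl → ¬fn }) ] (m≤n⇒m<n∨m≡n (≤-pred y<1+n))

Gap : (ℕ → Bool) → (ℕ → Bool) → ℕ → ℕ → Set
Gap f g j i = ∀ {x} → j < x → x < i → ¬ T (f x) × ¬ T (g x)

gap-adjacent : ∀ f g → Gap f g j (suc j)
gap-adjacent f g j<x x<1+j = ⊥-elim (<⇒≱ j<x (≤-pred x<1+j))

-- Scan the positions after j up to i, restarting at each element of f met;
-- d counts the positions still to be scanned.
closest-pair : ∀ f g → T (f j) → T (g i) → j < i →
  ∃₂ λ j′ i′ → T (f j′) × T (g i′) × j′ < i′ × Gap f g j′ i′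
closest-pair {j} {i} f g fj gi j<i =
  scan (i ∸ suc j) (m∸n+n≡m j<i) fj gi ≤-refl (gap-adjacent f g)
  where
  scan : ∀ d {j p i} → d + suc p ≡ i → T (f j) → T (g i) → j ≤ p → Gap f g j (suc p) →
    ∃₂ λ j′ i′ → T (f j′) × T (g i′) × j′ < i′ × Gap f g j′ i′
  scan zero    refl fj gi j≤p gap = _ , _ , fj , gi , s≤s j≤p , gap
  scan (suc d) {j} {p} eq fj gi j≤p gap with T? (f (suc p)) | T? (g (suc p))
  ... | _      | yes g₊   = j , suc p , fj , g₊ , s≤s j≤p , gap
  ... | yes f₊ | no _     = scan d (trans (+-suc d (suc p)) eq) f₊ gi ≤-refl (gap-adjacent f g)
  ... | no ¬f₊ | no ¬g₊   = scan d (trans (+-suc d (suc p)) eq) fj gi (m≤n⇒m≤1+n j≤p) gap′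
    where
    gap′ : Gap f g j (suc (suc p))
    gap′ j<x x<2+p with m≤n⇒m<n∨m≡n (≤-pred x<2+p)
    ... | inj₁ x<1+p = gap j<x x<1+p
    ... | inj₂ refl  = ¬f₊ , ¬g₊

edgeVertexDist-< : j < i → edgeVertexDist j i ≡ i ∸ suc j
edgeVertexDist-< {j} {i} j<i = begin
  ∣ j - i ∣ ⊓ ∣ suc j - i ∣ ≡⟨ cong₂ _⊓_ (m≤n⇒∣m-n∣≡n∸m (<⇒≤ j<i)) (m≤n⇒∣m-n∣≡n∸m j<i) ⟩
  (i ∸ j) ⊓ (i ∸ suc j)     ≡⟨ m≥n⇒m⊓n≡n (∸-monoʳ-≤ i (n≤1+n j)) ⟩
  i ∸ suc j                 ∎
  where open ≡-Reasoning

edgeVertexDist-≥ : i ≤ j → edgeVertexDist j i ≡ j ∸ i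
edgeVertexDist-≥ {i} {j} i≤j = begin
  ∣ j - i ∣ ⊓ ∣ suc j - i ∣ ≡⟨ cong₂ _⊓_ (m≤n⇒∣n-m∣≡n∸m i≤j) (m≤n⇒∣n-m∣≡n∸m (m≤n⇒m≤1+n i≤j)) ⟩
  (j ∸ i) ⊓ (suc j ∸ i)     ≡⟨ m≤n⇒m⊓n≡m (∸-monoˡ-≤ i (n≤1+n j)) ⟩
  j ∸ i                     ∎
  where open ≡-Reasoning

half-bound : ∀ {k m n} → k + k + m ≤ n → k ≤ (n ∸ m) / 2
half-bound {k} {m} {n} k+k+m≤n = begin
  k         ≡⟨ m*n/n≡m k 2 ⟨
  k * 2 / 2 ≤⟨ /-monoˡ-≤ 2 (m+n≤o⇒m≤o∸n (k * 2) (subst (λ c → c + m ≤ n) k+k≡k*2 k+k+m≤n)) ⟩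
  (n ∸ m) / 2 ∎
  where
  open ≤-Reasoning
  k+k≡k*2 : k + k ≡ k * 2
  k+k≡k*2 = sym (trans (*-comm k 2) (cong (k +_) (+-identityʳ k)))

-- The path has vertices 0, …, n and edges 0, …, n − 1; sets are packed into positions 0, …, n + 1.

module Packing {I A : ℕ → Bool} (q≥1 : 1 ≤ q)
  (I-bound : ∀ {i} → T (I i) → i < suc n)
  (A-bound : ∀ {j} → T (A j) → j < n)
  (independent : Disjoint I (shift I))
  (far : ∀ {j i} → T (A j) → T (I i) → q ≤ edgeVertexDist j i)
  where

  far-before : T (A j) → T (I i) → j < i → q ≤ i ∸ suc j
  far-before aj ii j<i = subst (q ≤_) (edgeVertexDist-< j<i) (far aj ii)

  far-after : T (A j) → T (I i) → i ≤ j → q ≤ j ∸ i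
  far-after aj ii i≤j = subst (q ≤_) (edgeVertexDist-≥ i≤j) (far aj ii)

  I∩A : Disjoint I A
  I∩A x ix ax = <⇒≱ q≥1 (subst (q ≤_) (n∸n≡0 x) (far-after ax ix ≤-refl))

  I∩shiftA : Disjoint I (shift A)
  I∩shiftA (suc x) ix ax = <⇒≱ q≥1 (subst (q ≤_) (n∸n≡0 x) (far-before ax ix (n<1+n x)))

  shiftI∩A : 2 ≤ q → Disjoint (shift I) A
  shiftI∩A q≥2 (suc x) ix ax = <⇒≱ q≥2 (subst (q ≤_) (m+n∸n≡m 1 x) (far-after ax ix (n≤1+n x)))

  bound-q≥1 : count I (suc n) + count I (suc n) + count A n ≤ suc (suc n)
  bound-q≥1 = ≤-trans (+-monoʳ-≤ _ (count-mono A (n≤1+n n)))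
    (packing independent I∩shiftA (disjoint-shift I∩A))

  packing-with-block : ∀ A′ B →
    Disjoint I A′ → Disjoint (shift I) A′ → Disjoint I B → Disjoint (shift I) B → Disjoint A′ B →
    count A n ≤ count A′ (suc (suc n)) → q ≤ count B (suc (suc n)) →
    count I (suc n) + count I (suc n) + (count A n + q) ≤ suc (suc n)
  packing-with-block A′ B I∩A′ sI∩A′ I∩B sI∩B A′∩B A≤A′ q≤B = ≤-trans
    (+-monoʳ-≤ (count I (suc n) + count I (suc n)) (+-mono-≤ A≤A′ q≤B))
    (subst (_≤ suc (suc n))
      (cong (count I (suc n) + count I (suc n) +_) (count-∪ A′ B (suc (suc n)) A′∩B))
      (packing independent (disjoint-∪ʳ I∩A′ I∩B) (disjoint-∪ʳ sI∩A′ sI∩B)))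

  bound-edge-before-vertex : 2 ≤ q → T (A j) → T (I i) → j < i → Gap A I j i →
    count I (suc n) + count I (suc n) + (count A n + q) ≤ suc (suc n)
  bound-edge-before-vertex {j} {i} q≥2 aj ii j<i gap = packing-with-block A (interval (suc j) q)
    I∩A
    (shiftI∩A q≥2)
    (λ x ix bx → proj₂ (gap′ bx) ix)
    shiftI∩B
    (λ x ax bx → proj₁ (gap′ bx) ax)
    (count-mono A (≤-trans (n≤1+n n) (n≤1+n (suc n))))
    (len≤count-interval (suc j) q (≤-trans block-end (<⇒≤ (m<n⇒m<1+n (I-bound ii)))))
    where
    block-end : suc j + q ≤ i
    block-end = subst (_≤ i) (+-comm q (suc j)) (m≤o∸n⇒m+n≤o q j<i (far-before aj ii j<i))

    gap′ : T (interval (suc j) q x) → ¬ T (A x) × ¬ T (I x)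
    gap′ bx = let (j<x , x<) = interval-bounds (suc j) bx in gap j<x (<-≤-trans x< block-end)

    shiftI∩B : Disjoint (shift I) (interval (suc j) q)
    shiftI∩B (suc x) ix bx with m≤n⇒m<n∨m≡n (≤-pred (proj₁ (interval-bounds (suc j) bx)))
    ... | inj₂ refl = I∩A _ ix aj
    ... | inj₁ j<x  = proj₂ (gap j<x (<-trans (n<1+n x)
                        (<-≤-trans (proj₂ (interval-bounds (suc j) bx)) block-end))) ix

  bound-vertices-before-edges : ∀ m → T (I m) → T (A j) → (∀ {x} → T (I x) → x ≤ m) →
    (∀ {x} → T (A x) → m ≤ x) →
    count I (suc n) + count I (suc n) + (count A n + q) ≤ suc (suc n)
  bound-vertices-before-edges m im aj I≤m m≤A = packing-with-block (shift (shift A)) (interval L q)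
    (disjoint-separated L I-below A′-above)
    (disjoint-separated L shiftI-below A′-above)
    (disjoint-separated L I-below (λ bx → proj₁ (interval-bounds L bx)))
    (disjoint-separated L shiftI-below (λ bx → proj₁ (interval-bounds L bx)))
    (λ x a′x bx → <⇒≱ (proj₂ (interval-bounds L bx)) (A′-after {x} a′x))
    ≤-refl
    (len≤count-interval L q (s≤s (s≤s (<⇒≤ (≤-<-trans (A-after aj) (A-bound aj))))))
    where
    L : ℕ
    L = suc (suc m)

    A-after : ∀ {x} → T (A x) → m + q ≤ x
    A-after {x} ax = subst (_≤ x) (+-comm q m) (m≤o∸n⇒m+n≤o q (m≤A ax) (far-after ax im (m≤A ax)))

    A′-after : ∀ {x} → T (shift (shift A) x) → L + q ≤ x
    A′-after {suc (suc x)} ax = s≤s (s≤s (A-after ax))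

    A′-above : ∀ {x} → T (shift (shift A) x) → L ≤ x
    A′-above a′x = ≤-trans (m≤m+n L q) (A′-after a′x)

    I-below : ∀ {x} → T (I x) → x < L
    I-below ix = s≤s (m≤n⇒m≤1+n (I≤m ix))

    shiftI-below : ∀ {x} → T (shift I x) → x < L
    shiftI-below {suc x} ix = s≤s (s≤s (I≤m ix))

  bound-q≥2 : 2 ≤ q → T (I i) → T (A j) →
    count I (suc n) + count I (suc n) + (count A n + q) ≤ suc (suc n)
  bound-q≥2 q≥2 ii aj with greatest I (suc n) (I-bound ii) ii
  ... | m , im , none-after with anyUpTo? (λ x → T? (A x)) m
  ...   | no no-edge-before = bound-vertices-before-edges m im aj
            (λ ix → ≮⇒≥ (λ m<x → none-after m<x (I-bound ix) ix))
            (λ ax → ≮⇒≥ (λ x<m → no-edge-before (_ , x<m , ax)))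
  ...   | yes (_ , j<m , aj′) with closest-pair A I aj′ im j<m
  ...     | _ , _ , aj″ , ii″ , j″<i″ , gap = bound-edge-before-vertex q≥2 aj″ ii″ j″<i″ gap

member : ∀ {n} → Subset n → ℕ → Bool
member []      _       = false
member (b ∷ p) zero    = b
member (b ∷ p) (suc x) = member p x

count-member : ∀ {n} (p : Subset n) → count (member p) n ≡ ∣ p ∣
count-member []            = refl
count-member (outside ∷ p) = count-member p
count-member (inside ∷ p)  = cong suc (count-member p)

∈⇒member : ∀ {n} {p : Subset n} {i} → i ∈ p → T (member p (toℕ i))
∈⇒member here        = _
∈⇒member (there i∈p) = ∈⇒member i∈p

member⇒∈ : ∀ {n} {p : Subset n} → T (member p x) → ∃ λ i → toℕ i ≡ x × i ∈ p
member⇒∈ {x = zero} {p = inside ∷ p} _  = zero , refl , here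
member⇒∈ {x = suc x} {p = _ ∷ p} px with member⇒∈ {x} {p = p} px
... | i , refl , i∈p = suc i , refl , there i∈p

member-bound : ∀ {n} (p : Subset n) → T (member p x) → x < n
member-bound p px with member⇒∈ {p = p} px
... | i , refl , _ = toℕ<n i

member-independent : ∀ {n} {p : Subset n} → Independent p →
  Disjoint (member p) (shift (member p))
member-independent {p = p} ind (suc x) px₊ px with member⇒∈ {x} {p = p} px
... | i , refl , i∈p = let (j , j≡1+i , j∈p) = member⇒∈ px₊ in ind i j i∈p j∈p j≡1+i

0<∣p∣⇒Nonempty : ∀ {n} (p : Subset n) → 0 < ∣ p ∣ → Nonempty p
0<∣p∣⇒Nonempty {n} p 0<∣p∣ with nonempty? p
... | yes ne    = ne
... | no empty = contradiction (trans (cong ∣_∣ (Empty-unique empty)) (∣⊥∣≡0 n)) (>⇒≢ 0<∣p∣)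

lemma2 : (q s a : ℕ) → q ≥ 1 → a ≥ 1 → suc a ≤ s →
    (I : Subset s) → NonemptySet I → Independent I →
    (A' : Subset (s ∸ 1)) → ∣ A' ∣ ≡ a →
    ((j : Fin (s ∸ 1)) (i : Fin s) → j ∈ A' → i ∈ I → q ≤ edgeVertexDist (toℕ j) (toℕ i)) →
    (q ≥ 2 → ∣ I ∣ ≤ (s + 1 ∸ (a + q)) / 2) × (q ≡ 1 → ∣ I ∣ ≤ (s + 1 ∸ a) / 2)
lemma2 q (suc n) a q≥1 a≥1 (s≤s _) I (i , i∈I) independent A' refl far =
  (λ q≥2 → half-bound (in-sizes (cong (_+ q) (count-member A'))
                                (bound-q≥2 q≥2 (∈⇒member i∈I) (∈⇒member (proj₂ edge))))) ,
  (λ _ → half-bound (in-sizes (count-member A') bound-q≥1))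
  where
  far′ : ∀ {j i} → T (member A' j) → T (member I i) → q ≤ edgeVertexDist j i
  far′ aj ii with member⇒∈ {p = A'} aj | member⇒∈ {p = I} ii
  ... | j , refl , j∈A' | i , refl , i∈I = far j i j∈A' i∈I

  edge : Nonempty A'
  edge = 0<∣p∣⇒Nonempty A' a≥1

  in-sizes : ∀ {m m′} → m ≡ m′ →
    count (member I) (suc n) + count (member I) (suc n) + m ≤ suc (suc n) →
    ∣ I ∣ + ∣ I ∣ + m′ ≤ suc n + 1
  in-sizes m≡m′ = subst₂ _≤_ (cong₂ _+_ (cong₂ _+_ (count-member I) (count-member I)) m≡m′)
    (+-comm 1 (suc n))

  open Packing q≥1 (member-bound I) (member-bound A') (member-independent independent) far′
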